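{- Let $q$ be a prime power with $q\equiv 1\pmod 4$ and $q\not\equiv1\pmod 3$. Let $a,b,c\in\mathbb{F}_{q^3}^*$ be distinct with $\mathrm{N}(a)=\mathrm{N}(b)=\mathrm{N}(c)=1$ and $\mathrm{T}(a^2)=\mathrm{T}(b^2)=\mathrm{T}(c^2)=0$. Then $2\,\mathrm{T}(ab)\,\mathrm{T}(ac)\,\mathrm{T}(bc)$ is a nonzero square in $\mathbb{F}_q$.
   Context: $\mathrm{T}(x)=x+x^q+x^{q^2}$ and $\mathrm{N}(x)=x^{q^2+q+1}$ are the trace and norm from $\mathbb{F}_{q^3}$ to $\mathbb{F}_q$. -}

module Defs where

open import Level using (Level; _⊔_)
open import Data.Nat using (ℕ; zero; suc)
open import Data.Fin using (Fin)
open import Data.Product using (Σ; ∃; _×_; _,_)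
open import Relation.Nullary using (¬_)
open import Relation.Binary.Definitions using (Decidable)
open import Relation.Binary.PropositionalEquality using (_≡_)
open import Data.Nat.Primality using (Prime)
open import Algebra.Bundles using (CommutativeRing)

IsPrimePower : ℕ → Set
IsPrimePower q = Σ ℕ λ p → Σ ℕ λ k → Prime p × (q ≡ p Data.Nat.^ suc k)

module _ {c ℓ : Level} (R : CommutativeRing c ℓ) where
  open CommutativeRing R

  pow : Carrier → ℕ → Carrier
  pow x zero    = 1#
  pow x (suc n) = x * pow x n

  record IsFiniteFieldOfSize (n : ℕ) : Set (c ⊔ ℓ) where
    field
      _≟_       : Decidable _≈_
      0≉1       : ¬ (0# ≈ 1#)
      inverse   : ∀ x → ¬ (x ≈ 0#) → ∃ λ y → x * y ≈ 1#
      enum      : Fin n → Carrier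
      enum-inj  : ∀ i j → enum i ≈ enum j → i ≡ j
      enum-surj : ∀ x → ∃ λ i → enum i ≈ x

  module _ (q : ℕ) where
    T : Carrier → Carrier
    T x = x + pow x q + pow x (q Data.Nat.* q)

    N : Carrier → Carrier
    N x = pow x (q Data.Nat.* q Data.Nat.+ q Data.Nat.+ 1)

    InFq : Carrier → Set ℓ
    InFq y = pow y q ≈ y

    NonzeroSquareInFq : Carrier → Set (c ⊔ ℓ)
    NonzeroSquareInFq v = ¬ (v ≈ 0#) × (∃ λ y → InFq y × (y * y ≈ v))

module Submission where

-- Write F x = x ^ q and let x̂ = (x, F x, F² x) be the vector of conjugates of
-- x, so that T(xy) = x̂ · ŷ and N(x) = F² x · F x · x.  The hypotheses say that
-- â, b̂, ĉ are isotropic, and Cauchy–Binet, (det M)² = det(M Mᵀ), for the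
-- matrix with rows â, b̂, ĉ gives d² = 2 T(ab) T(ac) T(bc) with d = det(â, b̂, ĉ).
-- As F³ x = x when N(x) = 1, F shifts conjugate vectors cyclically, so F d = d:
-- d lies in F_q.  The product is nonzero: 2 ≠ 0 since q is odd, and T(ab) = 0
-- would kill the minor a F b - F a b (Cauchy–Binet for â, b̂, e₃), making b / a
-- an element of F_q with cube N(b / a) = 1, hence b = a as 3 ∤ q - 1.

open import Defs
open import Level using (Level; _⊔_)
open import Data.Nat as ℕ using (ℕ; zero; suc; _<_; _!; _%_; _/_; s≤s; z≤n)
import Data.Nat.Properties as ℕ
open import Data.Nat.Divisibility using (_∣_; divides; ∣⇒≤; ∣1⇒≡1; m∣m*n)
open import Data.Nat.DivMod using (m/n*n≡m; m≡m%n+[m/n]*n; [m+kn]%n≡m%n)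
open import Data.Nat.Primality using (Prime; euclidsLemma; ¬prime[0]; ¬prime[1]; prime⇒irreducible; prime?)
open import Data.Nat.Coprimality using (Coprime; coprime-Bézout)
open import Data.Nat.GCD using (module Bézout)
open import Data.Nat.Tactic.RingSolver using (solve-∀)
open import Data.Nat.Combinatorics using (_C_; k![n∸k]!∣n!; nCn≡1)
open import Data.Nat.Combinatorics.Specification using (nCk≡n!/k![n-k]!)
open import Data.Fin as Fin using (Fin; toℕ; fromℕ; inject₁)
import Data.Fin.Properties as Fin
open import Data.Fin.Permutation using (Permutation; permutation)
open import Data.Sum using (inj₁; inj₂)
open import Data.Product using (_,_; proj₁; proj₂) renaming (_×_ to _∧_)
open import Data.Empty using (⊥-elim)
open import Function using (_∘_)
open import Relation.Nullary using (¬_; yes; no)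
open import Relation.Nullary.Decidable using (from-yes)
open import Relation.Binary.PropositionalEquality as ≡ using (_≡_)
open import Algebra.Bundles using (CommutativeRing)

-- A prime p does not divide m! for m < p, since it would have to divide
-- one of the factors 1, …, m.
prime∤factorial : ∀ {p} → Prime p → ∀ m → m < p → ¬ (p ∣ m !)
prime∤factorial pr zero    _   p∣1 = ¬prime[1] (≡.subst Prime (∣1⇒≡1 p∣1) pr)
prime∤factorial pr (suc m) m<p p∣m! with euclidsLemma (suc m) (m !) pr p∣m!
... | inj₁ p∣1+m = ℕ.<⇒≱ m<p (∣⇒≤ p∣1+m)
... | inj₂ p∣m!  = prime∤factorial pr m (ℕ.<-trans (ℕ.n<1+n m) m<p) p∣m!

-- A prime p divides the inner binomial coefficients p C k (0 < k < p):
-- it divides p! = (p C k) · k! · (p - k)! but neither k! nor (p - k)!.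
prime∣binomial : ∀ {p k} → Prime p → 0 < k → k < p → p ∣ p C k
prime∣binomial {p@(suc p-1)} {k} pr 0<k k<p
  with euclidsLemma (p C k) (k ! ℕ.* (p ℕ.∸ k) !) pr p∣product
  where
  instance _ = k ℕ.!* (p ℕ.∸ k) !≢0
  p∣product : p ∣ (p C k) ℕ.* (k ! ℕ.* (p ℕ.∸ k) !)
  p∣product = ≡.subst (p ∣_)
    (≡.sym (≡.trans (≡.cong (ℕ._* (k ! ℕ.* (p ℕ.∸ k) !)) (nCk≡n!/k![n-k]! (ℕ.<⇒≤ k<p)))
                    (m/n*n≡m (k![n∸k]!∣n! (ℕ.<⇒≤ k<p)))))
    (m∣m*n (p-1 !))
... | inj₁ p∣pCk = p∣pCk
... | inj₂ p∣rest with euclidsLemma (k !) ((p ℕ.∸ k) !) pr p∣rest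
...   | inj₁ p∣k!     = ⊥-elim (prime∤factorial pr k k<p p∣k!)
...   | inj₂ p∣[p-k]! = ⊥-elim (prime∤factorial pr (p ℕ.∸ k) (ℕ.∸-monoʳ-< 0<k (ℕ.<⇒≤ k<p)) p∣[p-k]!)
prime∣binomial {zero} pr = ⊥-elim (¬prime[0] pr)

cube-expansion : ∀ r → suc r ℕ.* suc r ℕ.* suc r ≡ 1 ℕ.+ r ℕ.* (suc r ℕ.* suc r ℕ.+ suc r ℕ.+ 1)
cube-expansion = solve-∀

prime∤⇒coprime : ∀ {p n} → Prime p → ¬ (p ∣ n) → Coprime p n
prime∤⇒coprime pr p∤n (d∣p , d∣n) with prime⇒irreducible pr d∣p
... | inj₁ d≡1 = d≡1
... | inj₂ ≡.refl = ⊥-elim (p∤n d∣n)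

coprime-3-pred : ∀ r → ¬ (suc r % 3 ≡ 1) → Coprime 3 r
coprime-3-pred r q≢1 = prime∤⇒coprime (from-yes (prime? 3)) 3∤r
  where
  3∤r : ¬ (3 ∣ r)
  3∤r (divides t ≡.refl) = q≢1 ([m+kn]%n≡m%n 1 t 3)

module PowerFacts {c ℓ : Level} (R : CommutativeRing c ℓ) where
  open CommutativeRing R
  open import Relation.Binary.Reasoning.Setoid setoid
  open import Algebra.Properties.CommutativeSemiring.Exp commutativeSemiring
  open import Algebra.Properties.Semiring.Mult semiring
  open import Algebra.Properties.Semiring.Sum semiring using (sum; sum-init-last; sum-cong-≋; sum-replicate-zero)
  open import Algebra.Properties.CommutativeSemiring.Binomial commutativeSemiring
    using (theorem; binomialTerm)

  pow≈^ : ∀ x n → pow R x n ≈ x ^ n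
  pow≈^ x zero    = refl
  pow≈^ x (suc n) = *-congˡ (pow≈^ x n)

  1^n≈1 : ∀ n → 1# ^ n ≈ 1#
  1^n≈1 zero    = refl
  1^n≈1 (suc n) = trans (*-identityˡ _) (1^n≈1 n)

  ^-multiple≈1 : ∀ {x e} → x ^ e ≈ 1# → ∀ k → x ^ (k ℕ.* e) ≈ 1#
  ^-multiple≈1 {x} {e} xᵉ≈1 k = begin
    x ^ (k ℕ.* e)  ≡⟨ ≡.cong (x ^_) (ℕ.*-comm k e) ⟩
    x ^ (e ℕ.* k)  ≈⟨ ^-assocʳ x e k ⟨
    (x ^ e) ^ k    ≈⟨ ^-congˡ k xᵉ≈1 ⟩
    1# ^ k         ≈⟨ 1^n≈1 k ⟩
    1#             ∎

  unit-from-Bézout : ∀ {x e f} i j → x ^ e ≈ 1# → x ^ f ≈ 1# →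
                     1 ℕ.+ i ℕ.* e ≡ j ℕ.* f → x ≈ 1#
  unit-from-Bézout {x} {e} {f} i j xᵉ≈1 xᶠ≈1 1+ie≡jf = begin
    x                    ≈⟨ *-identityʳ x ⟨
    x * 1#               ≈⟨ *-congˡ (^-multiple≈1 xᵉ≈1 i) ⟨
    x ^ (1 ℕ.+ i ℕ.* e)  ≡⟨ ≡.cong (x ^_) 1+ie≡jf ⟩
    x ^ (j ℕ.* f)        ≈⟨ ^-multiple≈1 xᶠ≈1 j ⟩
    1#                   ∎

  coprime-orders : ∀ {m n} → Coprime m n → ∀ {x} → x ^ m ≈ 1# → x ^ n ≈ 1# → x ≈ 1#
  coprime-orders m⊥n xᵐ≈1 xⁿ≈1 with coprime-Bézout m⊥n
  ... | Bézout.+- a b 1+bn≡am = unit-from-Bézout b a xⁿ≈1 xᵐ≈1 1+bn≡am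
  ... | Bézout.-+ a b 1+am≡bn = unit-from-Bézout a b xᵐ≈1 xⁿ≈1 1+am≡bn

  ×1-homo-^ : ∀ m j → (m ℕ.^ j) × 1# ≈ (m × 1#) ^ j
  ×1-homo-^ m zero    = +-identityʳ 1#
  ×1-homo-^ m (suc j) = trans (×1-homo-* m (m ℕ.^ j)) (*-congˡ (×1-homo-^ m j))

  multiple-annihilates : ∀ {n m} → n × 1# ≈ 0# → n ∣ m → ∀ z → m × z ≈ 0#
  multiple-annihilates {n} n·1≈0 (divides t ≡.refl) z = begin
    (t ℕ.* n) × z            ≈⟨ ×-congʳ (t ℕ.* n) (*-identityˡ z) ⟨
    (t ℕ.* n) × (1# * z)     ≈⟨ ×-assoc-* (t ℕ.* n) 1# z ⟨
    ((t ℕ.* n) × 1#) * z     ≈⟨ *-congʳ (×1-homo-* t n) ⟩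
    (t × 1#) * (n × 1#) * z  ≈⟨ *-congʳ (*-congˡ n·1≈0) ⟩
    (t × 1#) * 0# * z        ≈⟨ *-congʳ (zeroʳ _) ⟩
    0# * z                   ≈⟨ zeroˡ z ⟩
    0# ∎

  ×1-mod : ∀ {n} .{{_ : ℕ.NonZero n}} → n × 1# ≈ 0# → ∀ m → m × 1# ≈ (m % n) × 1#
  ×1-mod {n} n·1≈0 m = begin
    m × 1#                                  ≡⟨ ≡.cong (_× 1#) (m≡m%n+[m/n]*n m n) ⟩
    (m % n ℕ.+ (m / n) ℕ.* n) × 1#          ≈⟨ ×-homo-+ 1# (m % n) ((m / n) ℕ.* n) ⟩
    (m % n) × 1# + ((m / n) ℕ.* n) × 1#     ≈⟨ +-congˡ (multiple-annihilates n·1≈0 (divides (m / n) ≡.refl) 1#) ⟩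
    (m % n) × 1# + 0#                       ≈⟨ +-identityʳ _ ⟩
    (m % n) × 1# ∎

  AdditiveExponent : ℕ → Set (c ⊔ ℓ)
  AdditiveExponent e = ∀ x y → (x + y) ^ e ≈ x ^ e + y ^ e

  additive-* : ∀ {m n} → AdditiveExponent m → AdditiveExponent n → AdditiveExponent (m ℕ.* n)
  additive-* {m} {n} add-m add-n x y = begin
    (x + y) ^ (m ℕ.* n)            ≈⟨ ^-assocʳ (x + y) m n ⟨
    ((x + y) ^ m) ^ n              ≈⟨ ^-congˡ n (add-m x y) ⟩
    (x ^ m + y ^ m) ^ n            ≈⟨ add-n (x ^ m) (y ^ m) ⟩
    (x ^ m) ^ n + (y ^ m) ^ n      ≈⟨ +-cong (^-assocʳ x m n) (^-assocʳ y m n) ⟩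
    x ^ (m ℕ.* n) + y ^ (m ℕ.* n)  ∎

  additive-^ : ∀ {p} → AdditiveExponent p → ∀ j → AdditiveExponent (p ℕ.^ j)
  additive-^ add-p zero    x y = distribʳ 1# x y
  additive-^ {p} add-p (suc j) = additive-* {p} {p ℕ.^ j} add-p (additive-^ add-p j)

  -- Freshman's dream: in characteristic p the inner binomial coefficients
  -- of (x + y) ^ p vanish, because p divides them.
  freshmans-dream : ∀ {p} → Prime p → p × 1# ≈ 0# → AdditiveExponent p
  freshmans-dream {zero}  pr = ⊥-elim (¬prime[0] pr)
  freshmans-dream {suc s} pr p·1≈0 x y = begin
    (x + y) ^ p                                   ≈⟨ theorem p x y ⟩
    term Fin.zero + sum (λ i → term (Fin.suc i))  ≈⟨ +-congˡ (sum-init-last (λ i → term (Fin.suc i))) ⟩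
    term Fin.zero + (sum inner + term (fromℕ p))  ≈⟨ +-congˡ (+-congʳ (sum-cong-≋ {s} inner≈0)) ⟩
    term Fin.zero + (sum {s} (λ _ → 0#) + term (fromℕ p)) ≈⟨ +-congˡ (+-congʳ (sum-replicate-zero s)) ⟩
    term Fin.zero + (0# + term (fromℕ p))         ≈⟨ +-cong first-term (trans (+-identityˡ _) last-term) ⟩
    y ^ p + x ^ p                                 ≈⟨ +-comm _ _ ⟩
    x ^ p + y ^ p                                 ∎
    where
    p : ℕ
    p = suc s
    term : Fin (suc p) → Carrier
    term = binomialTerm x y p
    inner : Fin s → Carrier
    inner i = term (Fin.suc (inject₁ i))
    inner≈0 : ∀ i → inner i ≈ 0#
    inner≈0 i = multiple-annihilates p·1≈0 (prime∣binomial pr (s≤s z≤n) k<p) _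
      where
      k<p : suc (toℕ (inject₁ i)) < p
      k<p = s≤s (≡.subst (_< s) (≡.sym (Fin.toℕ-inject₁ i)) (Fin.toℕ<n i))
    first-term : term Fin.zero ≈ y ^ p
    first-term = trans (+-identityʳ _) (*-identityˡ _)
    last-term : term (fromℕ p) ≈ x ^ p
    last-term rewrite Fin.toℕ-fromℕ s | nCn≡1 p | ℕ.n∸n≡0 s =
      trans (+-identityʳ _) (*-identityʳ _)

module IsotropicVectors {c ℓ : Level} (R : CommutativeRing c ℓ) where
  open CommutativeRing R
  open import Relation.Binary.Reasoning.Setoid setoid
  open import Algebra.Solver.Ring.NaturalCoefficients.Default commutativeSemiring
  import Algebra.Properties.Group +-group as AdditiveGroup

  two : Carrier
  two = 1# + 1#

  square-of-difference : ∀ u v W → u * u + v * v ≈ W + two * u * v → (u - v) * (u - v) ≈ W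
  square-of-difference u v W u²+v²≈W+2uv =
    AdditiveGroup.∙-cancelʳ (two * u * v) ((u - v) * (u - v)) W (begin
      (u - v) * (u - v) + two * u * v            ≈⟨ +-congˡ (*-congʳ (*-congˡ u-v+v≈u)) ⟨
      (u - v) * (u - v) + two * (u - v + v) * v  ≈⟨ square-of-sum (u - v) v ⟩
      (u - v + v) * (u - v + v) + v * v          ≈⟨ +-congʳ (*-cong u-v+v≈u u-v+v≈u) ⟩
      u * u + v * v                              ≈⟨ u²+v²≈W+2uv ⟩
      W + two * u * v                            ∎)
    where
    u-v+v≈u : u - v + v ≈ u
    u-v+v≈u = trans (+-assoc u (- v) v) (trans (+-congˡ (-‿inverseˡ v)) (+-identityʳ u))
    square-of-sum : ∀ w v → w * w + two * (w + v) * v ≈ (w + v) * (w + v) + v * v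
    square-of-sum = solve 2 (λ w v → w :* w :+ con 2 :* (w :+ v) :* v := (w :+ v) :* (w :+ v) :+ v :* v) refl

  record Triple : Set c where
    constructor ⟨_,_,_⟩
    field
      x₁ x₂ x₃ : Carrier
  open Triple using (x₃)

  infix 7 _·_
  _·_ : Triple → Triple → Carrier
  ⟨ a₁ , a₂ , a₃ ⟩ · ⟨ b₁ , b₂ , b₃ ⟩ = a₁ * b₁ + a₂ * b₂ + a₃ * b₃

  det⁺ det⁻ det : Triple → Triple → Triple → Carrier
  det⁺ ⟨ a₁ , a₂ , a₃ ⟩ ⟨ b₁ , b₂ , b₃ ⟩ ⟨ c₁ , c₂ , c₃ ⟩ = a₁ * b₂ * c₃ + a₂ * b₃ * c₁ + a₃ * b₁ * c₂
  det⁻ ⟨ a₁ , a₂ , a₃ ⟩ ⟨ b₁ , b₂ , b₃ ⟩ ⟨ c₁ , c₂ , c₃ ⟩ = a₁ * b₃ * c₂ + a₂ * b₁ * c₃ + a₃ * b₂ * c₁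
  det a b c = det⁺ a b c - det⁻ a b c

  infix 4 _≋_
  _≋_ : Triple → Triple → Set ℓ
  ⟨ a₁ , a₂ , a₃ ⟩ ≋ ⟨ b₁ , b₂ , b₃ ⟩ = a₁ ≈ b₁ ∧ a₂ ≈ b₂ ∧ a₃ ≈ b₃

  rotate : Triple → Triple
  rotate ⟨ a₁ , a₂ , a₃ ⟩ = ⟨ a₂ , a₃ , a₁ ⟩

  det-cong : ∀ {a a′ b b′ c c′} → a ≋ a′ → b ≋ b′ → c ≋ c′ → det a b c ≈ det a′ b′ c′
  det-cong (a₁ , a₂ , a₃) (b₁ , b₂ , b₃) (c₁ , c₂ , c₃) =
    +-cong (+-cong (+-cong (product a₁ b₂ c₃) (product a₂ b₃ c₁)) (product a₃ b₁ c₂))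
           (-‿cong (+-cong (+-cong (product a₁ b₃ c₂) (product a₂ b₁ c₃)) (product a₃ b₂ c₁)))
    where
    product : ∀ {x x′ y y′ z z′} → x ≈ x′ → y ≈ y′ → z ≈ z′ → x * y * z ≈ x′ * y′ * z′
    product x≈ y≈ z≈ = *-cong (*-cong x≈ y≈) z≈

  -- Shifting all coordinates cyclically permutes the three terms of det⁺ and
  -- of det⁻ cyclically, so it preserves det.
  det-rotate : ∀ a b c → det (rotate a) (rotate b) (rotate c) ≈ det a b c
  det-rotate a b c = +-cong (+-rotate _ _ _) (-‿cong (+-rotate _ _ _))
    where
    +-rotate : ∀ x y z → y + z + x ≈ x + y + z
    +-rotate = solve 3 (λ x y z → y :+ z :+ x := x :+ y :+ z) refl

  minor⁺ minor⁻ : Triple → Triple → Carrier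
  minor⁺ ⟨ a₁ , a₂ , a₃ ⟩ ⟨ b₁ , b₂ , b₃ ⟩ = a₁ * b₂
  minor⁻ ⟨ a₁ , a₂ , a₃ ⟩ ⟨ b₁ , b₂ , b₃ ⟩ = a₂ * b₁

  -- Cauchy–Binet for the rows a, b, e₃ (subtraction-free form): the squared
  -- minor equals the Gram determinant of a, b, e₃.
  minor-gram-identity : ∀ a b →
    minor⁺ a b * minor⁺ a b + minor⁻ a b * minor⁻ a b
      + ((a · a) * (x₃ b * x₃ b) + (b · b) * (x₃ a * x₃ a) + (a · b) * (a · b))
    ≈ ((a · a) * (b · b) + two * (a · b) * (x₃ a * x₃ b)) + two * minor⁺ a b * minor⁻ a b
  minor-gram-identity ⟨ a₁ , a₂ , a₃ ⟩ ⟨ b₁ , b₂ , b₃ ⟩ = solve 6 (λ a₁ a₂ a₃ b₁ b₂ b₃ →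
      let aa = a₁ :* a₁ :+ a₂ :* a₂ :+ a₃ :* a₃
          bb = b₁ :* b₁ :+ b₂ :* b₂ :+ b₃ :* b₃
          ab = a₁ :* b₁ :+ a₂ :* b₂ :+ a₃ :* b₃
      in (a₁ :* b₂) :* (a₁ :* b₂) :+ (a₂ :* b₁) :* (a₂ :* b₁)
           :+ (aa :* (b₃ :* b₃) :+ bb :* (a₃ :* a₃) :+ ab :* ab)
         := (aa :* bb :+ con 2 :* ab :* (a₃ :* b₃)) :+ con 2 :* (a₁ :* b₂) :* (a₂ :* b₁))
    refl a₁ a₂ a₃ b₁ b₂ b₃

  -- Cauchy–Binet for a 3 × 3 matrix (subtraction-free form): det² equals the
  -- Gram determinant of the rows.
  det-gram-identity : ∀ a b c →
    det⁺ a b c * det⁺ a b c + det⁻ a b c * det⁻ a b c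
      + ((a · a) * ((b · c) * (b · c)) + (b · b) * ((a · c) * (a · c)) + (c · c) * ((a · b) * (a · b)))
    ≈ (two * (a · b) * (a · c) * (b · c) + (a · a) * (b · b) * (c · c)) + two * det⁺ a b c * det⁻ a b c
  det-gram-identity ⟨ a₁ , a₂ , a₃ ⟩ ⟨ b₁ , b₂ , b₃ ⟩ ⟨ c₁ , c₂ , c₃ ⟩ = solve 9 (λ a₁ a₂ a₃ b₁ b₂ b₃ c₁ c₂ c₃ →
      let d⁺ = a₁ :* b₂ :* c₃ :+ a₂ :* b₃ :* c₁ :+ a₃ :* b₁ :* c₂
          d⁻ = a₁ :* b₃ :* c₂ :+ a₂ :* b₁ :* c₃ :+ a₃ :* b₂ :* c₁
          aa = a₁ :* a₁ :+ a₂ :* a₂ :+ a₃ :* a₃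
          bb = b₁ :* b₁ :+ b₂ :* b₂ :+ b₃ :* b₃
          cc = c₁ :* c₁ :+ c₂ :* c₂ :+ c₃ :* c₃
          ab = a₁ :* b₁ :+ a₂ :* b₂ :+ a₃ :* b₃
          ac = a₁ :* c₁ :+ a₂ :* c₂ :+ a₃ :* c₃
          bc = b₁ :* c₁ :+ b₂ :* c₂ :+ b₃ :* c₃
      in d⁺ :* d⁺ :+ d⁻ :* d⁻ :+ (aa :* (bc :* bc) :+ bb :* (ac :* ac) :+ cc :* (ab :* ab))
         := (con 2 :* ab :* ac :* bc :+ aa :* bb :* cc) :+ con 2 :* d⁺ :* d⁻)
    refl a₁ a₂ a₃ b₁ b₂ b₃ c₁ c₂ c₃

  +-vanishingʳ : ∀ z {e} → e ≈ 0# → z + e ≈ z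
  +-vanishingʳ z e≈0 = trans (+-congˡ e≈0) (+-identityʳ z)

  vanishing-* : ∀ {u} t → u ≈ 0# → u * t ≈ 0#
  vanishing-* t u≈0 = trans (*-congʳ u≈0) (zeroˡ t)

  sum-of-vanishing : ∀ {u v w} → u ≈ 0# → v ≈ 0# → w ≈ 0# → u + v + w ≈ 0#
  sum-of-vanishing u≈0 v≈0 w≈0 =
    trans (+-cong (+-cong u≈0 v≈0) w≈0) (trans (+-identityʳ _) (+-identityʳ 0#))

  isotropic-minor² : ∀ a b → a · a ≈ 0# → b · b ≈ 0# → a · b ≈ 0# →
    (minor⁺ a b - minor⁻ a b) * (minor⁺ a b - minor⁻ a b) ≈ 0#
  isotropic-minor² a b aa≈0 bb≈0 ab≈0 = trans (square-of-difference _ _ _ (begin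
    minor⁺ a b * minor⁺ a b + minor⁻ a b * minor⁻ a b
      ≈⟨ +-vanishingʳ _ (sum-of-vanishing (vanishing-* _ aa≈0) (vanishing-* _ bb≈0) (vanishing-* _ ab≈0)) ⟨
    _ ≈⟨ minor-gram-identity a b ⟩
    _ ∎)) W≈0
    where
    W≈0 : (a · a) * (b · b) + two * (a · b) * (x₃ a * x₃ b) ≈ 0#
    W≈0 = trans (+-vanishingʳ _ (vanishing-* _ (trans (*-congˡ ab≈0) (zeroʳ two)))) (vanishing-* _ aa≈0)

  isotropic-det² : ∀ a b c → a · a ≈ 0# → b · b ≈ 0# → c · c ≈ 0# →
    det a b c * det a b c ≈ two * (a · b) * (a · c) * (b · c)
  isotropic-det² a b c aa≈0 bb≈0 cc≈0 = trans (square-of-difference _ _ _ (begin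
    det⁺ a b c * det⁺ a b c + det⁻ a b c * det⁻ a b c
      ≈⟨ +-vanishingʳ _ (sum-of-vanishing (vanishing-* _ aa≈0) (vanishing-* _ bb≈0) (vanishing-* _ cc≈0)) ⟨
    _ ≈⟨ det-gram-identity a b c ⟩
    _ ∎)) (+-vanishingʳ _ (vanishing-* _ (vanishing-* _ aa≈0)))

module FiniteFieldFacts {c ℓ : Level} (R : CommutativeRing c ℓ) {n : ℕ} (FF : IsFiniteFieldOfSize R n) where
  open CommutativeRing R
  open IsFiniteFieldOfSize FF
  open import Relation.Binary.Reasoning.Setoid setoid
  open import Algebra.Properties.CommutativeSemiring.Exp commutativeSemiring using (_^_)
  open import Algebra.Properties.Semiring.Mult semiring using (_×_)
  open import Algebra.Properties.CommutativeMonoid.Sum +-commutativeMonoid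
    using (sum-syntax; sum-cong-≋; sum-replicate; ∑-distrib-+; ∑-permute)
  import Algebra.Properties.Group +-group as AdditiveGroup

  *-cancelˡ : ∀ {x y z} → ¬ (x ≈ 0#) → x * y ≈ x * z → y ≈ z
  *-cancelˡ {x} {y} {z} x≉0 xy≈xz with inverse x x≉0
  ... | x⁻¹ , xx⁻¹≈1 = begin
    y               ≈⟨ divide y ⟨
    x⁻¹ * (x * y)   ≈⟨ *-congˡ xy≈xz ⟩
    x⁻¹ * (x * z)   ≈⟨ divide z ⟩
    z               ∎
    where
    divide : ∀ w → x⁻¹ * (x * w) ≈ w
    divide w = begin
      x⁻¹ * (x * w)  ≈⟨ *-assoc x⁻¹ x w ⟨
      x⁻¹ * x * w    ≈⟨ *-congʳ (trans (*-comm x⁻¹ x) xx⁻¹≈1) ⟩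
      1# * w         ≈⟨ *-identityˡ w ⟩
      w              ∎

  nonzero-* : ∀ {x y} → ¬ (x ≈ 0#) → ¬ (y ≈ 0#) → ¬ (x * y ≈ 0#)
  nonzero-* {x} x≉0 y≉0 xy≈0 = y≉0 (*-cancelˡ x≉0 (trans xy≈0 (sym (zeroʳ x))))

  nonzero-^ : ∀ {x} → ¬ (x ≈ 0#) → ∀ k → ¬ (x ^ k ≈ 0#)
  nonzero-^ x≉0 zero    1≈0 = 0≉1 (sym 1≈0)
  nonzero-^ x≉0 (suc k)     = nonzero-* x≉0 (nonzero-^ x≉0 k)

  ^≈0⇒≈0 : ∀ {x} k → x ^ k ≈ 0# → x ≈ 0#
  ^≈0⇒≈0 {x} k xᵏ≈0 with x ≟ 0#
  ... | yes x≈0 = x≈0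
  ... | no  x≉0 = ⊥-elim (nonzero-^ x≉0 k xᵏ≈0)

  square≈0⇒≈0 : ∀ {x} → x * x ≈ 0# → x ≈ 0#
  square≈0⇒≈0 {x} x²≈0 = ^≈0⇒≈0 2 (trans (*-congˡ (*-identityʳ x)) x²≈0)

  -- The additive group has order n: translation by t permutes the n
  -- elements, so their sum S satisfies S + n·t = S.
  size-annihilates : ∀ t → n × t ≈ 0#
  size-annihilates t = AdditiveGroup.∙-cancelˡ S (n × t) 0# (begin
    S + n × t                        ≈⟨ +-congˡ (sum-replicate n) ⟨
    S + ∑[ i < n ] t                 ≈⟨ ∑-distrib-+ enum (λ _ → t) ⟨
    ∑[ i < n ] (enum i + t)          ≈⟨ sum-cong-≋ translate-correct ⟨
    ∑[ i < n ] enum (translate i)    ≈⟨ ∑-permute enum translation ⟨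
    S                                ≈⟨ +-identityʳ S ⟨
    S + 0#                           ∎)
    where
    S : Carrier
    S = ∑[ i < n ] enum i
    index : Carrier → Fin n
    index x = proj₁ (enum-surj x)
    index-correct : ∀ x → enum (index x) ≈ x
    index-correct x = proj₂ (enum-surj x)
    translate untranslate : Fin n → Fin n
    translate i = index (enum i + t)
    untranslate i = index (enum i - t)
    translate-correct : ∀ i → enum (translate i) ≈ enum i + t
    translate-correct i = index-correct (enum i + t)
    cancel-t : ∀ w → w - t + t ≈ w
    cancel-t w = trans (+-assoc w (- t) t) (trans (+-congˡ (-‿inverseˡ t)) (+-identityʳ w))
    uncancel-t : ∀ w → w + t - t ≈ w
    uncancel-t w = trans (+-assoc w t (- t)) (trans (+-congˡ (-‿inverseʳ t)) (+-identityʳ w))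
    translate∘untranslate : ∀ i → translate (untranslate i) ≡ i
    translate∘untranslate i = enum-inj _ _ (trans (translate-correct (untranslate i))
      (trans (+-congʳ (index-correct (enum i - t))) (cancel-t (enum i))))
    untranslate∘translate : ∀ i → untranslate (translate i) ≡ i
    untranslate∘translate i = enum-inj _ _ (trans (index-correct (enum (translate i) - t))
      (trans (+-congʳ (translate-correct i)) (uncancel-t (enum i))))
    translation : Permutation n n
    translation = permutation translate untranslate translate∘untranslate untranslate∘translate

module Frobenius {c ℓ : Level} (R : CommutativeRing c ℓ) (r : ℕ)
                 (q-prime-power : IsPrimePower (suc r))
                 (FF : IsFiniteFieldOfSize R (suc r ℕ.^ 3)) where
  open CommutativeRing R
  open PowerFacts R
  open IsotropicVectors R
  open FiniteFieldFacts R FF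
  open IsFiniteFieldOfSize FF using (0≉1; inverse)
  open import Relation.Binary.Reasoning.Setoid setoid
  open import Algebra.Properties.CommutativeSemiring.Exp commutativeSemiring
    using (_^_; ^-congˡ; ^-homo-*; ^-assocʳ; ^-distrib-*)
  open import Algebra.Properties.Semiring.Mult semiring using (_×_; ×1-homo-*)
  open import Algebra.Solver.Ring.NaturalCoefficients.Default commutativeSemiring
  import Algebra.Properties.Group +-group as AdditiveGroup

  q p k : ℕ
  q = suc r
  p = proj₁ q-prime-power
  k = proj₁ (proj₂ q-prime-power)

  p-prime : Prime p
  p-prime = proj₁ (proj₂ (proj₂ q-prime-power))

  q≡p^[1+k] : q ≡ p ℕ.^ suc k
  q≡p^[1+k] = proj₂ (proj₂ (proj₂ q-prime-power))

  p∣q : p ∣ q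
  p∣q = ≡.subst (p ∣_) (≡.sym q≡p^[1+k]) (m∣m*n (p ℕ.^ k))

  -- R has characteristic p: (p · 1) ^ (3(k + 1)) = q³ · 1 = 0 and R is a field.
  characteristic : p × 1# ≈ 0#
  characteristic = ^≈0⇒≈0 (suc k ℕ.* 3) (begin
    (p × 1#) ^ (suc k ℕ.* 3)        ≈⟨ ×1-homo-^ p (suc k ℕ.* 3) ⟨
    (p ℕ.^ (suc k ℕ.* 3)) × 1#      ≡⟨ ≡.cong (_× 1#) (ℕ.^-*-assoc p (suc k) 3) ⟨
    ((p ℕ.^ suc k) ℕ.^ 3) × 1#      ≡⟨ ≡.cong (λ t → (t ℕ.^ 3) × 1#) q≡p^[1+k] ⟨
    (q ℕ.^ 3) × 1#                  ≈⟨ size-annihilates 1# ⟩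
    0#                              ∎)

  -- 2 ≠ 0: otherwise 4 · 1 = 0, and q ≡ 1 (mod 4) would give 1 = q · 1 = 0.
  two≉0 : q % 4 ≡ 1 → ¬ (two ≈ 0#)
  two≉0 q≡1[4] 2≈0 = 0≉1 (begin
    0#            ≈⟨ multiple-annihilates characteristic p∣q 1# ⟨
    q × 1#        ≈⟨ ×1-mod {4} 4·1≈0 q ⟩
    (q % 4) × 1#  ≡⟨ ≡.cong (_× 1#) q≡1[4] ⟩
    1 × 1#        ≈⟨ +-identityʳ 1# ⟩
    1#            ∎)
    where
    4·1≈0 : 4 × 1# ≈ 0#
    4·1≈0 = begin
      4 × 1#                ≈⟨ ×1-homo-* 2 2 ⟩
      (2 × 1#) * (2 × 1#)   ≈⟨ *-congʳ (trans (+-congˡ (+-identityʳ 1#)) 2≈0) ⟩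
      0# * (2 × 1#)         ≈⟨ zeroˡ _ ⟩
      0#                    ∎

  F : Carrier → Carrier
  F x = x ^ q

  F-cong : ∀ {x y} → x ≈ y → F x ≈ F y
  F-cong = ^-congˡ q

  F-+ : AdditiveExponent q
  F-+ = ≡.subst AdditiveExponent (≡.sym q≡p^[1+k])
    (additive-^ {p} (freshmans-dream p-prime characteristic) (suc k))

  F-* : ∀ x y → F (x * y) ≈ F x * F y
  F-* x y = ^-distrib-* x y q

  F-1 : F 1# ≈ 1#
  F-1 = 1^n≈1 q

  F-neg : ∀ x → F (- x) ≈ - F x
  F-neg x = AdditiveGroup.inverseʳ-unique (F x) (F (- x))
    (trans (sym (F-+ x (- x))) (trans (F-cong (-‿inverseʳ x)) (zeroˡ _)))

  F-*3 : ∀ x y z → F (x * y * z) ≈ F x * F y * F z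
  F-*3 x y z = trans (F-* (x * y) z) (*-congʳ (F-* x y))

  F-+3 : ∀ x y z → F (x + y + z) ≈ F x + F y + F z
  F-+3 x y z = trans (F-+ (x + y) z) (+-congʳ (F-+ x y))

  F-map : Triple → Triple
  F-map ⟨ x₁ , x₂ , x₃ ⟩ = ⟨ F x₁ , F x₂ , F x₃ ⟩

  F-det : ∀ a b c → F (det a b c) ≈ det (F-map a) (F-map b) (F-map c)
  F-det a b c = begin
    F (det⁺ a b c - det⁻ a b c)        ≈⟨ F-+ _ _ ⟩
    F (det⁺ a b c) + F (- det⁻ a b c)  ≈⟨ +-cong (F-sum-of-products _ _ _ _ _ _ _ _ _)
                                                 (trans (F-neg _) (-‿cong (F-sum-of-products _ _ _ _ _ _ _ _ _))) ⟩
    det (F-map a) (F-map b) (F-map c)  ∎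
    where
    F-sum-of-products : ∀ x₁ y₁ z₁ x₂ y₂ z₂ x₃ y₃ z₃ →
      F (x₁ * y₁ * z₁ + x₂ * y₂ * z₂ + x₃ * y₃ * z₃)
        ≈ F x₁ * F y₁ * F z₁ + F x₂ * F y₂ * F z₂ + F x₃ * F y₃ * F z₃
    F-sum-of-products x₁ y₁ z₁ x₂ y₂ z₂ x₃ y₃ z₃ =
      trans (F-+3 _ _ _) (+-cong (+-cong (F-*3 x₁ y₁ z₁) (F-*3 x₂ y₂ z₂)) (F-*3 x₃ y₃ z₃))

  conjugates : Carrier → Triple
  conjugates x = ⟨ x , F x , F (F x) ⟩

  pow-q² : ∀ x → pow R x (q ℕ.* q) ≈ F (F x)
  pow-q² x = trans (pow≈^ x (q ℕ.* q)) (sym (^-assocʳ x q q))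

  T-as-dot : ∀ x y → T R q (x * y) ≈ conjugates x · conjugates y
  T-as-dot x y = +-cong (+-congˡ (trans (pow≈^ (x * y) q) (F-* x y)))
                        (trans (pow-q² (x * y)) (trans (F-cong (F-* x y)) (F-* (F x) (F y))))

  dot-vanishes : ∀ {x y} → T R q (x * y) ≈ 0# → conjugates x · conjugates y ≈ 0#
  dot-vanishes {x} {y} Txy≈0 = trans (sym (T-as-dot x y)) Txy≈0

  norm-exponent : ℕ
  norm-exponent = q ℕ.* q ℕ.+ q ℕ.+ 1

  N-expand : ∀ x → N R q x ≈ F (F x) * F x * x
  N-expand x = begin
    pow R x norm-exponent                    ≈⟨ pow≈^ x norm-exponent ⟩
    x ^ (q ℕ.* q ℕ.+ q ℕ.+ 1)                ≈⟨ ^-homo-* x (q ℕ.* q ℕ.+ q) 1 ⟩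
    x ^ (q ℕ.* q ℕ.+ q) * (x * 1#)           ≈⟨ *-cong (^-homo-* x (q ℕ.* q) q) (*-identityʳ x) ⟩
    x ^ (q ℕ.* q) * F x * x                  ≈⟨ *-congʳ (*-congʳ (^-assocʳ x q q)) ⟨
    F (F x) * F x * x                        ∎

  N-* : ∀ x y → N R q (x * y) ≈ N R q x * N R q y
  N-* x y = begin
    pow R (x * y) norm-exponent                 ≈⟨ pow≈^ (x * y) norm-exponent ⟩
    (x * y) ^ norm-exponent                     ≈⟨ ^-distrib-* x y norm-exponent ⟩
    x ^ norm-exponent * y ^ norm-exponent       ≈⟨ *-cong (pow≈^ x norm-exponent) (pow≈^ y norm-exponent) ⟨
    pow R x norm-exponent * pow R y norm-exponent ∎

  N-cong : ∀ {x y} → x ≈ y → N R q x ≈ N R q y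
  N-cong {x} {y} x≈y =
    trans (pow≈^ x norm-exponent) (trans (^-congˡ norm-exponent x≈y) (sym (pow≈^ y norm-exponent)))

  -- Norm-one elements satisfy F³ x = x, as q³ = 1 + (q - 1)(q² + q + 1).
  F³-norm-one : ∀ {x} → N R q x ≈ 1# → F (F (F x)) ≈ x
  F³-norm-one {x} Nx≈1 = begin
    F (F (F x))                      ≈⟨ F-cong (^-assocʳ x q q) ⟩
    (x ^ (q ℕ.* q)) ^ q              ≈⟨ ^-assocʳ x (q ℕ.* q) q ⟩
    x ^ (q ℕ.* q ℕ.* q)              ≡⟨ ≡.cong (x ^_) (cube-expansion r) ⟩
    x * x ^ (r ℕ.* norm-exponent)    ≈⟨ *-congˡ (^-multiple≈1 (trans (sym (pow≈^ x norm-exponent)) Nx≈1) r) ⟩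
    x * 1#                           ≈⟨ *-identityʳ x ⟩
    x                                ∎

  F-conjugates : ∀ {x} → N R q x ≈ 1# → F-map (conjugates x) ≋ rotate (conjugates x)
  F-conjugates Nx≈1 = refl , refl , F³-norm-one Nx≈1

  det-conjugates-fixed : ∀ {a b c} → N R q a ≈ 1# → N R q b ≈ 1# → N R q c ≈ 1# →
    F (det (conjugates a) (conjugates b) (conjugates c)) ≈ det (conjugates a) (conjugates b) (conjugates c)
  det-conjugates-fixed {a} {b} {c} Na≈1 Nb≈1 Nc≈1 = begin
    F (det A B C)                                ≈⟨ F-det A B C ⟩
    det (F-map A) (F-map B) (F-map C)            ≈⟨ det-cong (F-conjugates Na≈1) (F-conjugates Nb≈1) (F-conjugates Nc≈1) ⟩
    det (rotate A) (rotate B) (rotate C)         ≈⟨ det-rotate A B C ⟩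
    det A B C                                    ∎
    where
    A B C : Triple
    A = conjugates a
    B = conjugates b
    C = conjugates c

  -- Elements of F_q (fixed by F) that are cube roots of unity are trivial
  -- when 3 is coprime to q - 1, as they also satisfy l ^ (q - 1) = 1.
  fixed-cube-root : Coprime 3 r → ∀ {l} → F l ≈ l → l ^ 3 ≈ 1# → l ≈ 1#
  fixed-cube-root 3⊥r {l} Fl≈l l³≈1 = coprime-orders 3⊥r l³≈1 lʳ≈1
    where
    l≉0 : ¬ (l ≈ 0#)
    l≉0 l≈0 = 0≉1 (trans (sym (vanishing-* (l ^ 2) l≈0)) l³≈1)
    lʳ≈1 : l ^ r ≈ 1#
    lʳ≈1 = *-cancelˡ l≉0 (trans Fl≈l (sym (*-identityʳ l)))

  fixed-ratio : ∀ {a a′ b} → a * a′ ≈ 1# → a * F b ≈ F a * b → F (b * a′) ≈ b * a′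
  fixed-ratio {a} {a′} {b} aa′≈1 aFb≈Fab = begin
    F (b * a′)                    ≈⟨ F-* b a′ ⟩
    F b * F a′                    ≈⟨ *-identityˡ _ ⟨
    1# * (F b * F a′)             ≈⟨ *-congʳ aa′≈1 ⟨
    a * a′ * (F b * F a′)         ≈⟨ rearrange a a′ (F b) (F a′) ⟩
    a * F b * (a′ * F a′)         ≈⟨ *-congʳ aFb≈Fab ⟩
    F a * b * (a′ * F a′)         ≈⟨ rearrange (F a) b a′ (F a′) ⟩
    F a * a′ * (b * F a′)         ≈⟨ regroup (F a) a′ b (F a′) ⟩
    b * a′ * (F a * F a′)         ≈⟨ *-congˡ (trans (sym (F-* a a′)) (trans (F-cong aa′≈1) F-1)) ⟩
    b * a′ * 1#                   ≈⟨ *-identityʳ _ ⟩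
    b * a′                        ∎
    where
    rearrange : ∀ w x y z → w * x * (y * z) ≈ w * y * (x * z)
    rearrange = solve 4 (λ w x y z → w :* x :* (y :* z) := w :* y :* (x :* z)) refl
    regroup : ∀ w x y z → w * x * (y * z) ≈ y * x * (w * z)
    regroup = solve 4 (λ w x y z → w :* x :* (y :* z) := y :* x :* (w :* z)) refl

  -- Two norm-one elements whose conjugate vectors are isotropic and
  -- orthogonal are equal, provided 3 is coprime to q - 1: the ratio l = b / a
  -- lies in F_q (a 2 × 2 minor vanishes) and is a cube root of unity.
  orthogonal⇒equal : Coprime 3 r → ∀ {a b} → ¬ (a ≈ 0#) → N R q a ≈ 1# → N R q b ≈ 1# →
    T R q (a * a) ≈ 0# → T R q (b * b) ≈ 0# → T R q (a * b) ≈ 0# → a ≈ b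
  orthogonal⇒equal 3⊥r {a} {b} a≉0 Na≈1 Nb≈1 Taa≈0 Tbb≈0 Tab≈0 with inverse a a≉0
  ... | a′ , aa′≈1 = begin
    a       ≈⟨ *-identityˡ a ⟨
    1# * a  ≈⟨ *-congʳ l≈1 ⟨
    l * a   ≈⟨ la≈b ⟩
    b       ∎
    where
    l : Carrier
    l = b * a′
    la≈b : l * a ≈ b
    la≈b = trans (*-assoc b a′ a) (trans (*-congˡ (trans (*-comm a′ a) aa′≈1)) (*-identityʳ b))
    aFb≈Fab : a * F b ≈ F a * b
    aFb≈Fab = AdditiveGroup.x∙y⁻¹≈ε⇒x≈y _ _ (square≈0⇒≈0
      (isotropic-minor² (conjugates a) (conjugates b) (dot-vanishes Taa≈0) (dot-vanishes Tbb≈0) (dot-vanishes Tab≈0)))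
    Fl≈l : F l ≈ l
    Fl≈l = fixed-ratio aa′≈1 aFb≈Fab
    l³≈1 : l ^ 3 ≈ 1#
    l³≈1 = begin
      l * (l * (l * 1#))  ≈⟨ solve 1 (λ x → x :* (x :* (x :* con 1)) := x :* x :* x) refl l ⟩
      l * l * l           ≈⟨ *-congʳ (*-cong (trans (F-cong Fl≈l) Fl≈l) Fl≈l) ⟨
      F (F l) * F l * l   ≈⟨ N-expand l ⟨
      N R q l             ≈⟨ *-identityʳ _ ⟨
      N R q l * 1#        ≈⟨ *-congˡ Na≈1 ⟨
      N R q l * N R q a   ≈⟨ N-* l a ⟨
      N R q (l * a)       ≈⟨ N-cong la≈b ⟩
      N R q b             ≈⟨ Nb≈1 ⟩
      1#                  ∎
    l≈1 : l ≈ 1#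
    l≈1 = fixed-cube-root 3⊥r Fl≈l l³≈1


mainTheorem15 : ∀ {c ℓ : Level} (R : CommutativeRing c ℓ) (q : ℕ) →
    IsPrimePower q → q % 4 ≡ 1 → ¬ (q % 3 ≡ 1) →
    IsFiniteFieldOfSize R (q ℕ.^ 3) →
    let open CommutativeRing R in
    (a b c : Carrier) →
    ¬ (a ≈ 0#) → ¬ (b ≈ 0#) → ¬ (c ≈ 0#) →
    ¬ (a ≈ b) → ¬ (a ≈ c) → ¬ (b ≈ c) →
    N R q a ≈ 1# → N R q b ≈ 1# → N R q c ≈ 1# →
    T R q (a * a) ≈ 0# → T R q (b * b) ≈ 0# → T R q (c * c) ≈ 0# →
    NonzeroSquareInFq R q ((1# + 1#) * T R q (a * b) * T R q (a * c) * T R q (b * c))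
mainTheorem15 R zero _ ()
mainTheorem15 R (suc r) q-prime-power q≡1[4] q≢1[3] FF a b c a≉0 b≉0 c≉0 a≉b a≉c b≉c
              Na≈1 Nb≈1 Nc≈1 Taa≈0 Tbb≈0 Tcc≈0 =
  nonzero-* (nonzero-* (nonzero-* (two≉0 q≡1[4]) Tab≉0) Tac≉0) Tbc≉0 , d , d∈Fq , d²≈
  where
  open CommutativeRing R
  open PowerFacts R using (pow≈^)
  open IsotropicVectors R using (two; det; isotropic-det²)
  open FiniteFieldFacts R FF using (nonzero-*)
  open Frobenius R r q-prime-power FF
  3⊥r : Coprime 3 r
  3⊥r = coprime-3-pred r q≢1[3]
  Tab≉0 : ¬ (T R q (a * b) ≈ 0#)
  Tab≉0 = a≉b ∘ orthogonal⇒equal 3⊥r a≉0 Na≈1 Nb≈1 Taa≈0 Tbb≈0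
  Tac≉0 : ¬ (T R q (a * c) ≈ 0#)
  Tac≉0 = a≉c ∘ orthogonal⇒equal 3⊥r a≉0 Na≈1 Nc≈1 Taa≈0 Tcc≈0
  Tbc≉0 : ¬ (T R q (b * c) ≈ 0#)
  Tbc≉0 = b≉c ∘ orthogonal⇒equal 3⊥r b≉0 Nb≈1 Nc≈1 Tbb≈0 Tcc≈0
  d : Carrier
  d = det (conjugates a) (conjugates b) (conjugates c)
  d∈Fq : InFq R q d
  d∈Fq = trans (pow≈^ d q) (det-conjugates-fixed Na≈1 Nb≈1 Nc≈1)
  d²≈ : d * d ≈ two * T R q (a * b) * T R q (a * c) * T R q (b * c)
  d²≈ = trans (isotropic-det² (conjugates a) (conjugates b) (conjugates c)
                 (dot-vanishes Taa≈0) (dot-vanishes Tbb≈0) (dot-vanishes Tcc≈0))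
              (sym (*-cong (*-cong (*-congˡ (T-as-dot a b)) (T-as-dot a c)) (T-as-dot b c)))
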